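{- Let $G=(V,E)$ be a finite simple undirected graph and let $h$ be a positive integer. Then for every edge $e\in E$, $\lim_{n\to\infty}H^{(n)}\mathrm{sup}(e)=t(e,h)-2$, where $H^{(n)}\mathrm{sup}$ is the higher-order H-index sequence and $t(e,h)$ the $h$-trussness, both defined below.
   Context: For a graph $S$, $\mathrm{dist}_S$ is shortest-path distance in $S$; for a vertex $x$, $N_S(x,h)=\{y\neq x:\mathrm{dist}_S(x,y)\le h\}$; for an edge $e=(u,v)$ of $S$, $\triangle_S(e,h)=N_S(u,h)\cap N_S(v,h)$ (common $h$-neighbors) and $\sup_S(e,h)=|\triangle_S(e,h)|$ ($h$-support). A subgraph $S=(V_S,E_S)$ of $G$ has $V_S\subseteq V$, $E_S\subseteq E$, with endpoints of edges of $E_S$ in $V_S$; $h$-supports in $S$ use distances in $S$. For an integer $k$, the $(k,h)$-truss of $G$ is the maximal subgraph $S$ of $G$ with $\sup_S(f,h)\ge k-2$ for all $f\in E_S$. The $h$-trussness $t(e,h)$ of $e\in E$ is the largest $k$ such that the $(k,h)$-truss of $G$ contains $e$. For a finite multiset $M$ of nonnegative integers, $\mathcal{H}(M)$ is the largest integer $y\ge 0$ such that at least $y$ elements of $M$ are $\ge y$. Define $H^{(0)}\mathrm{sup}(e)=\sup_G(e,h)$ for $e\in E$. For $n\ge1$ and vertices $a,b$, let $P^{(n)}(a,b)=\max_p\min\{H^{(n-1)}\mathrm{sup}(f): f\text{ an edge of }p\}$ over all paths $p$ in $G$ from $a$ to $b$ with at most $h$ edges; and for $e=(u,v)\in E$ let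 $H^{(n)}\mathrm{sup}(e)=\mathcal{H}\big(\{\min(P^{(n)}(u,w),P^{(n)}(v,w)) : w\in\triangle_G(e,h)\}\big)$ (a multiset indexed by $w$). -}

module Defs where

open import Data.Bool using (Bool; true; false; _∧_; _∨_; not; if_then_else_)
open import Data.Nat using (ℕ; zero; suc; _≤_; _∸_; _⊔_; _⊓_; _≤ᵇ_)
open import Data.Fin using (Fin; _≟_)
open import Data.List using (List; []; _∷_; map; length; foldr; _++_; [_]; upTo; concatMap; allFin)
open import Data.Bool.ListAction using (any; all)
open import Data.Product using (Σ; _×_; _,_)
open import Relation.Nullary.Decidable using (⌊_⌋)
open import Relation.Binary.PropositionalEquality using (_≡_)

record Graph : Set where
  field
    n      : ℕ
    adj    : Fin n → Fin n → Bool
    sym    : ∀ u v → adj u v ≡ adj v u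
    irrefl : ∀ u → adj u u ≡ false

BRel : ℕ → Set
BRel n = Fin n → Fin n → Bool

module _ {n : ℕ} where

  eqb : Fin n → Fin n → Bool
  eqb x y = ⌊ x ≟ y ⌋

  -- reach E k x y = true  iff  dist_E(x,y) ≤ k  (BFS layers)
  reach : BRel n → ℕ → Fin n → Fin n → Bool
  reach E zero    x y = eqb x y
  reach E (suc k) x y = reach E k x y ∨ any (λ z → reach E k x z ∧ E z y) (allFin n)

  nbr : BRel n → ℕ → Fin n → Fin n → Bool
  nbr E h x y = not (eqb y x) ∧ reach E h x y

  tri : BRel n → ℕ → Fin n → Fin n → Fin n → Bool
  tri E h u v w = nbr E h u w ∧ nbr E h v w

countB : {A : Set} → (A → Bool) → List A → ℕ
countB p []       = 0
countB p (x ∷ xs) = if p x then suc (countB p xs) else countB p xs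

filterB : {A : Set} → (A → Bool) → List A → List A
filterB p []       = []
filterB p (x ∷ xs) = if p x then x ∷ filterB p xs else filterB p xs

sup : {n : ℕ} → BRel n → ℕ → Fin n → Fin n → ℕ
sup {n} E h u v = countB (tri E h u v) (allFin n)

record Subgraph (G : Graph) : Set where
  open Graph G
  field
    VS     : Fin n → Bool
    ES     : Fin n → Fin n → Bool
    ES-sym : ∀ u v → ES u v ≡ ES v u
    ES⊆E   : ∀ u v → ES u v ≡ true → adj u v ≡ true
    ES-l   : ∀ u v → ES u v ≡ true → VS u ≡ true
    ES-r   : ∀ u v → ES u v ≡ true → VS v ≡ true

module _ {G : Graph} where
  open Graph G
  open Subgraph

  _⊆S_ : Subgraph G → Subgraph G → Set
  S ⊆S T = (∀ x → VS S x ≡ true → VS T x ≡ true)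
         × (∀ u v → ES S u v ≡ true → ES T u v ≡ true)

  Good : ℕ → ℕ → Subgraph G → Set
  Good h k S = ∀ u v → ES S u v ≡ true → k ∸ 2 ≤ sup (ES S) h u v

  IsTruss : ℕ → ℕ → Subgraph G → Set
  IsTruss h k S = Good h k S × (∀ S' → Good h k S' → S' ⊆S S)

InTruss : (G : Graph) → ℕ → ℕ → Fin (Graph.n G) → Fin (Graph.n G) → Set
InTruss G h k u v = Σ (Subgraph G) λ S → IsTruss h k S × (Subgraph.ES S u v ≡ true)

IsTrussness : (G : Graph) → ℕ → Fin (Graph.n G) → Fin (Graph.n G) → ℕ → Set
IsTrussness G h u v t = InTruss G h t u v × (∀ k → InTruss G h k u v → k ≤ t)

-- ℋ(M): largest y with at least y elements of M that are ≥ y (such y ≤ |M|)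
hindex : List ℕ → ℕ
hindex M = foldr _⊔_ 0
  (map (λ y → if y ≤ᵇ countB (λ x → y ≤ᵇ x) M then y else 0) (upTo (suc (length M))))

maxL : List ℕ → ℕ
maxL = foldr _⊔_ 0

minL : List ℕ → ℕ
minL []       = 0
minL (x ∷ xs) = foldr _⊓_ x xs

edgesOf : {A : Set} → List A → List (A × A)
edgesOf (x ∷ y ∷ r) = (x , y) ∷ edgesOf (y ∷ r)
edgesOf _           = []

module _ {n : ℕ} where

  seqs : ℕ → List (List (Fin n))
  seqs zero    = [] ∷ []
  seqs (suc m) = concatMap (λ x → map (x ∷_) (seqs m)) (allFin n)

  distinct : List (Fin n) → Bool
  distinct []       = true
  distinct (x ∷ xs) = not (any (eqb x) xs) ∧ distinct xs

  isPath : BRel n → List (Fin n) → Bool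
  isPath A p = distinct p ∧ all (λ { (x , y) → A x y }) (edgesOf p)

  -- all paths in A from a to b with between 1 and h edges
  paths : BRel n → ℕ → Fin n → Fin n → List (List (Fin n))
  paths A h a b = filterB (isPath A)
    (concatMap (λ m → map (λ mid → a ∷ (mid ++ [ b ])) (seqs m)) (upTo h))

  bottleneck : BRel n → ℕ → (Fin n → Fin n → ℕ) → Fin n → Fin n → ℕ
  bottleneck A h H a b =
    maxL (map (λ p → minL (map (λ { (x , y) → H x y }) (edgesOf p))) (paths A h a b))

Hsup : (G : Graph) → ℕ → ℕ → Fin (Graph.n G) → Fin (Graph.n G) → ℕ
Hsup G h zero    u v = sup (Graph.adj G) h u v
Hsup G h (suc m) u v =
  hindex (map (λ w → bottleneck adj h (Hsup G h m) u w ⊓ bottleneck adj h (Hsup G h m) v w)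
              (filterB (tri adj h u v) (allFin (Graph.n G))))
  where adj = Graph.adj G

{-# OPTIONS --safe #-}
-- The sequence H⁽ᵐ⁾ is pointwise non-increasing: H⁽¹⁾ ≤ H⁽⁰⁾ because an h-index never exceeds
-- the number of triangle vertices, and each step is monotone in the previous layer. Being
-- ℕ-valued on finitely many pairs, it reaches a fixed point L = H⁽ᴺ⁾. Everything else rests on
-- one property of bottlenecks: for c ≥ 1 and a ≠ b, P(a,b) ≥ c iff a and b are joined by a walk
-- of at most h edges, all of H-value ≥ c (a shortest such walk is a path). Hence a subgraph in
-- which every edge has h-support ≥ c keeps all its edges at H⁽ᵐ⁾ ≥ c for every m, while at the
-- fixed point the edges with L ≥ c form such a subgraph. So the (k,h)-truss consists of the
-- edges with L ≥ k - 2, t(e,h) = L(e) + 2, and for m ≥ N the value H⁽ᵐ⁾(e) is squeezed between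
-- t(e,h) - 2 and L(e).
module Submission where

open import Defs
open import Data.Bool using (Bool; true; false; _∧_; _∨_; not; if_then_else_)
open import Data.Bool.ListAction using (any; all)
open import Data.Bool.Properties using (T-≡; ∧-comm; ∨-zeroʳ; ∨-identityʳ)
open import Data.Fin using (Fin; _≟_)
open import Data.List
  using (List; []; _∷_; map; length; _++_; [_]; upTo; concatMap; allFin; cartesianProduct)
open import Data.List.Membership.Propositional using (_∈_; find; lose)
open import Data.List.Membership.Propositional.Properties
  using (∈-map⁺; ∈-map⁻; ∈-upTo⁺; ∈-upTo⁻; ∈-allFin; ∈-cartesianProduct⁺; foldr-selective)
open import Data.List.Properties
  using (length-map; map-cong; foldr-preservesᵇ; foldr-preservesʳ; foldr-forcesᵇ)
open import Data.List.Relation.Unary.All as All using (All; []; _∷_)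
import Data.List.Relation.Unary.All.Properties as All
open import Data.List.Relation.Unary.Any using (here; there)
import Data.List.Relation.Unary.Any.Properties as Any
open import Data.Nat
  using (ℕ; zero; suc; _≤_; _<_; _∸_; _+_; _⊓_; _≤ᵇ_; z≤n; s≤s; _≤′_; ≤′-refl; ≤′-step)
open import Data.Nat.ListAction using (sum)
open import Data.Nat.Properties hiding (_≟_)
open import Data.Product using (Σ; _×_; _,_; ∃-syntax)
open import Data.Sum using (_⊎_; inj₁; inj₂)
open import Function using (_∘_; Equivalence)
open import Relation.Binary.PropositionalEquality
  using (_≡_; _≢_; refl; sym; trans; cong; cong₂; subst; module ≡-Reasoning)
open import Relation.Nullary using (yes; no; contradiction)
open import Relation.Nullary.Decidable using (isYes≗does; dec-true; dec-false; toWitness)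

∧-intro : ∀ {a b} → a ≡ true → b ≡ true → a ∧ b ≡ true
∧-intro refl refl = refl

∧-elimˡ : ∀ {a b} → a ∧ b ≡ true → a ≡ true
∧-elimˡ {true} _ = refl

∧-elimʳ : ∀ {a b} → a ∧ b ≡ true → b ≡ true
∧-elimʳ {true} b≡true = b≡true

∨-introˡ : ∀ {a b} → a ≡ true → a ∨ b ≡ true
∨-introˡ refl = refl

∨-introʳ : ∀ {a b} → b ≡ true → a ∨ b ≡ true
∨-introʳ {a} refl = ∨-zeroʳ a

∨-elim : ∀ {a b} → a ∨ b ≡ true → a ≡ true ⊎ b ≡ true
∨-elim {true}  _      = inj₁ refl
∨-elim {false} b≡true = inj₂ b≡true

≤ᵇ≡true⇒≤ : ∀ {m n} → (m ≤ᵇ n) ≡ true → m ≤ n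
≤ᵇ≡true⇒≤ {m} {n} = ≤ᵇ⇒≤ m n ∘ Equivalence.from T-≡

≤⇒≤ᵇ≡true : ∀ {m n} → m ≤ n → (m ≤ᵇ n) ≡ true
≤⇒≤ᵇ≡true = Equivalence.to T-≡ ∘ ≤⇒≤ᵇ

module _ {A : Set} where

  any-intro : ∀ (p : A → Bool) {x xs} → x ∈ xs → p x ≡ true → any p xs ≡ true
  any-intro p x∈xs px = Equivalence.to T-≡ (Any.any⁺ p (lose x∈xs (Equivalence.from T-≡ px)))

  any-elim : ∀ (p : A → Bool) xs → any p xs ≡ true → ∃[ x ] p x ≡ true
  any-elim p xs pxs with find (Any.any⁻ p xs (Equivalence.from T-≡ pxs))
  ... | x , _ , px = x , Equivalence.to T-≡ px

  all-intro : ∀ (p : A → Bool) {xs} → All (λ x → p x ≡ true) xs → all p xs ≡ true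
  all-intro p = Equivalence.to T-≡ ∘ All.all⁻ p ∘ All.map (Equivalence.from T-≡)

  all-elim : ∀ (p : A → Bool) xs → all p xs ≡ true → All (λ x → p x ≡ true) xs
  all-elim p xs = All.map (Equivalence.to T-≡) ∘ All.all⁺ p xs ∘ Equivalence.from T-≡

  countB-mono : ∀ {p q : A → Bool} → (∀ x → p x ≡ true → q x ≡ true) →
                ∀ xs → countB p xs ≤ countB q xs
  countB-mono p⇒q [] = z≤n
  countB-mono {p} {q} p⇒q (x ∷ xs) with p x in px | q x in qx
  ... | true  | true  = s≤s (countB-mono p⇒q xs)
  ... | true  | false = contradiction (trans (sym (p⇒q x px)) qx) λ ()
  ... | false | true  = m≤n⇒m≤1+n (countB-mono p⇒q xs)
  ... | false | false = countB-mono p⇒q xs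

  countB-cong : ∀ {p q : A → Bool} → (∀ x → p x ≡ q x) → ∀ xs → countB p xs ≡ countB q xs
  countB-cong p≗q []       = refl
  countB-cong p≗q (x ∷ xs) rewrite p≗q x | countB-cong p≗q xs = refl

  countB≤length : ∀ (p : A → Bool) xs → countB p xs ≤ length xs
  countB≤length p [] = z≤n
  countB≤length p (x ∷ xs) with p x
  ... | true  = s≤s (countB≤length p xs)
  ... | false = m≤n⇒m≤1+n (countB≤length p xs)

  length-filterB : ∀ (p : A → Bool) xs → length (filterB p xs) ≡ countB p xs
  length-filterB p [] = refl
  length-filterB p (x ∷ xs) with p x
  ... | true  = cong suc (length-filterB p xs)
  ... | false = length-filterB p xs

  filterB-cong : ∀ {p q : A → Bool} → (∀ x → p x ≡ q x) → ∀ xs → filterB p xs ≡ filterB q xs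
  filterB-cong p≗q []       = refl
  filterB-cong p≗q (x ∷ xs) rewrite p≗q x | filterB-cong p≗q xs = refl

  countB-map-filterB : ∀ {B : Set} (q : B → Bool) (f : A → B) (p : A → Bool) xs →
                       countB q (map f (filterB p xs)) ≡ countB (λ x → p x ∧ q (f x)) xs
  countB-map-filterB q f p [] = refl
  countB-map-filterB q f p (x ∷ xs) with p x
  ... | true  = cong (λ k → if q (f x) then suc k else k) (countB-map-filterB q f p xs)
  ... | false = countB-map-filterB q f p xs

  ∈-filterB⁺ : ∀ (p : A → Bool) {x xs} → x ∈ xs → p x ≡ true → x ∈ filterB p xs
  ∈-filterB⁺ p {xs = y ∷ ys} (here refl)  px rewrite px = here refl
  ∈-filterB⁺ p {xs = y ∷ ys} (there x∈ys) px with p y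
  ... | true  = there (∈-filterB⁺ p x∈ys px)
  ... | false = ∈-filterB⁺ p x∈ys px

  ∈-filterB⁻ : ∀ (p : A → Bool) {x} xs → x ∈ filterB p xs → x ∈ xs × p x ≡ true
  ∈-filterB⁻ p (y ∷ ys) x∈ with p y in py
  ∈-filterB⁻ p (y ∷ ys) (here refl) | true = here refl , py
  ∈-filterB⁻ p (y ∷ ys) (there x∈)  | true with ∈-filterB⁻ p ys x∈
  ... | x∈ys , px = there x∈ys , px
  ∈-filterB⁻ p (y ∷ ys) x∈          | false with ∈-filterB⁻ p ys x∈
  ... | x∈ys , px = there x∈ys , px

  ∈-concatMap⁺ : ∀ {B : Set} (f : A → List B) {x xs y} →
                 x ∈ xs → y ∈ f x → y ∈ concatMap f xs
  ∈-concatMap⁺ f x∈xs y∈fx = Any.concatMap⁺ f (lose x∈xs y∈fx)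

  ∈-concatMap⁻ : ∀ {B : Set} (f : A → List B) {xs y} →
                 y ∈ concatMap f xs → ∃[ x ] x ∈ xs × y ∈ f x
  ∈-concatMap⁻ f = find ∘ Any.concatMap⁻ f

  ≤minL-map⁺ : ∀ {c} (g : A → ℕ) xs → xs ≢ [] → All (λ x → c ≤ g x) xs → c ≤ minL (map g xs)
  ≤minL-map⁺     g []       xs≢[] _              = contradiction refl xs≢[]
  ≤minL-map⁺ {c} g (x ∷ xs) _     (c≤gx ∷ c≤gxs) =
    foldr-preservesᵇ {P = c ≤_} {f = _⊓_} ⊓-glb c≤gx (All.map⁺ c≤gxs)

  ≤minL-map⁻ : ∀ {c} (g : A → ℕ) xs → c ≤ minL (map g xs) → All (λ x → c ≤ g x) xs
  ≤minL-map⁻     g []       _     = []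
  ≤minL-map⁻ {c} g (x ∷ xs) c≤min = ≤-trans c≤min min≤head ∷ All.map⁻ (≤-tail c≤min)
    where
    min≤head : minL (map g (x ∷ xs)) ≤ g x
    min≤head = foldr-preservesʳ {P = _≤ g x} {f = _⊓_} (λ y → ≤-trans (m⊓n≤n y _)) ≤-refl (map g xs)
    ≤-tail : c ≤ minL (map g (x ∷ xs)) → All (c ≤_) (map g xs)
    ≤-tail = foldr-forcesᵇ {P = c ≤_} {f = _⊓_}
      (λ y z c≤y⊓z → m≤n⊓o⇒m≤n y z c≤y⊓z , m≤n⊓o⇒m≤o y z c≤y⊓z) (g x) (map g xs)

  minL-map-mono : ∀ {f g : A → ℕ} → (∀ x → f x ≤ g x) → ∀ xs → minL (map f xs) ≤ minL (map g xs)
  minL-map-mono         f≤g []          = z≤n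
  minL-map-mono {f} {g} f≤g xs@(_ ∷ _) =
    ≤minL-map⁺ g xs (λ ()) (All.map (λ {x} c≤fx → ≤-trans c≤fx (f≤g x)) (≤minL-map⁻ f xs ≤-refl))

  maxL-map-mono : ∀ {f g : A → ℕ} → (∀ x → f x ≤ g x) → ∀ xs → maxL (map f xs) ≤ maxL (map g xs)
  maxL-map-mono f≤g []       = z≤n
  maxL-map-mono f≤g (x ∷ xs) = ⊔-mono-≤ (f≤g x) (maxL-map-mono f≤g xs)

  sum-map-mono : ∀ {f g : A → ℕ} → (∀ x → f x ≤ g x) → ∀ xs → sum (map f xs) ≤ sum (map g xs)
  sum-map-mono f≤g []       = z≤n
  sum-map-mono f≤g (x ∷ xs) = +-mono-≤ (f≤g x) (sum-map-mono f≤g xs)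

  sum-map-≡⇒≡ : ∀ {f g : A → ℕ} → (∀ x → f x ≤ g x) → ∀ xs →
                sum (map f xs) ≡ sum (map g xs) → ∀ {x} → x ∈ xs → f x ≡ g x
  sum-map-≡⇒≡ {f} {g} f≤g (y ∷ ys) sums≡ = λ where
      (here refl)  → head≡
      (there x∈ys) → sum-map-≡⇒≡ f≤g ys tail≡ x∈ys
    where
    head≡ : f y ≡ g y
    head≡ = ≤-antisym (f≤g y)
      (≮⇒≥ λ fy<gy → <⇒≢ (+-mono-<-≤ fy<gy (sum-map-mono f≤g ys)) sums≡)
    tail≡ : sum (map f ys) ≡ sum (map g ys)
    tail≡ = +-cancelˡ-≡ (g y) _ _ (trans (cong (_+ sum (map f ys)) (sym head≡)) sums≡)

x≤maxL : ∀ {x xs} → x ∈ xs → x ≤ maxL xs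
x≤maxL (here refl)  = m≤m⊔n _ _
x≤maxL (there x∈xs) = ≤-trans (x≤maxL x∈xs) (m≤n⊔m _ _)

maxL-witness : ∀ {c} xs → 0 < c → c ≤ maxL xs → ∃[ x ] x ∈ xs × c ≤ x
maxL-witness {c} xs 0<c c≤max with foldr-selective ⊔-sel 0 xs
... | inj₁ max≡0  = contradiction (subst (c ≤_) max≡0 c≤max) (<⇒≱ 0<c)
... | inj₂ max∈xs = maxL xs , max∈xs , c≤max

-- h-index

count≥ : ℕ → List ℕ → ℕ
count≥ y = countB (y ≤ᵇ_)

count≥-antitone : ∀ {y y′} → y ≤ y′ → ∀ M → count≥ y′ M ≤ count≥ y M
count≥-antitone y≤y′ = countB-mono λ x y′≤x → ≤⇒≤ᵇ≡true (≤-trans y≤y′ (≤ᵇ≡true⇒≤ y′≤x))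

-- hindex M is the maximum of hindexCandidate M over 0, 1, …, length M.
hindexCandidate : List ℕ → ℕ → ℕ
hindexCandidate M y = if y ≤ᵇ count≥ y M then y else 0

hindexCandidate≤count≥ : ∀ M y → hindexCandidate M y ≤ count≥ (hindexCandidate M y) M
hindexCandidate≤count≥ M y with y ≤ᵇ count≥ y M in y≤count
... | true  = ≤ᵇ≡true⇒≤ y≤count
... | false = z≤n

≤hindex⁺ : ∀ {c} M → c ≤ count≥ c M → c ≤ hindex M
≤hindex⁺ {c} M c≤count =
  ≤-trans (≤-reflexive (sym candidate≡c)) (x≤maxL (∈-map⁺ (hindexCandidate M) c∈range))
  where
  candidate≡c : hindexCandidate M c ≡ c
  candidate≡c rewrite ≤⇒≤ᵇ≡true c≤count = refl
  c∈range : c ∈ upTo (suc (length M))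
  c∈range = ∈-upTo⁺ (s≤s (≤-trans c≤count (countB≤length _ M)))

≤hindex⁻ : ∀ {c} M → c ≤ hindex M → c ≤ count≥ c M
≤hindex⁻ {zero}  M _   = z≤n
≤hindex⁻ {suc c} M c≤h
  with maxL-witness (map (hindexCandidate M) (upTo (suc (length M)))) (s≤s z≤n) c≤h
... | _ , cy∈ , c≤cy with ∈-map⁻ (hindexCandidate M) {xs = upTo (suc (length M))} cy∈
... | y , _ , refl =
  ≤-trans c≤cy (≤-trans (hindexCandidate≤count≥ M y) (count≥-antitone c≤cy M))

hindex≤length : ∀ M → hindex M ≤ length M
hindex≤length M = ≤-trans (≤hindex⁻ M ≤-refl) (countB≤length _ M)

-- Antitone sequences

antitone⇒≤ : ∀ (f : ℕ → ℕ) → (∀ m → f (suc m) ≤ f m) → ∀ {N m} → N ≤ m → f m ≤ f N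
antitone⇒≤ f anti = go ∘ ≤⇒≤′
  where
  go : ∀ {N m} → N ≤′ m → f m ≤ f N
  go ≤′-refl        = ≤-refl
  go (≤′-step N≤′m) = ≤-trans (anti _) (go N≤′m)

antitone⇒plateau : ∀ (f : ℕ → ℕ) → (∀ m → f (suc m) ≤ f m) → ∃[ N ] f (suc N) ≡ f N
antitone⇒plateau f anti = search (f 0) 0 ≤-refl
  where
  search : ∀ budget m → f m ≤ budget → ∃[ N ] f (suc N) ≡ f N
  search budget m fm≤b with m≤n⇒m<n∨m≡n (anti m)
  ... | inj₂ plateau = m , plateau
  search zero    m fm≤0 | inj₁ drop = contradiction (≤-trans drop fm≤0) λ ()
  search (suc b) m fm≤b | inj₁ drop = search b (suc m) (≤-pred (≤-trans drop fm≤b))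

antitone-family⇒plateau : ∀ {A : Set} (F : ℕ → A → ℕ) xs → (∀ a → a ∈ xs) →
  (∀ m a → F (suc m) a ≤ F m a) → ∃[ N ] (∀ a → F (suc N) a ≡ F N a)
antitone-family⇒plateau F xs complete anti
  with antitone⇒plateau (λ m → sum (map (F m) xs)) (λ m → sum-map-mono (anti m) xs)
... | N , plateau = N , λ a → sum-map-≡⇒≡ (anti N) xs plateau (complete a)

-- Walks and paths

module _ {n : ℕ} where

  eqb⇒≡ : ∀ {x y : Fin n} → eqb x y ≡ true → x ≡ y
  eqb⇒≡ {x} {y} = toWitness {a? = x ≟ y} ∘ Equivalence.from T-≡

  eqb-refl : ∀ (x : Fin n) → eqb x x ≡ true
  eqb-refl x = trans (isYes≗does (x ≟ x)) (dec-true (x ≟ x) refl)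

  eqb-≢ : ∀ {x y : Fin n} → x ≢ y → eqb x y ≡ false
  eqb-≢ {x} {y} = trans (isYes≗does (x ≟ y)) ∘ dec-false (x ≟ y)

  _⊆ᴱ_ : BRel n → BRel n → Set
  E ⊆ᴱ E′ = ∀ {x y} → E x y ≡ true → E′ x y ≡ true

  superlevel : BRel n → (Fin n → Fin n → ℕ) → ℕ → BRel n
  superlevel A H c x y = A x y ∧ (c ≤ᵇ H x y)

  data Walk (E : BRel n) : ℕ → Fin n → Fin n → Set where
    stay : ∀ {k a} → Walk E k a a
    step : ∀ {k a z b} → E a z ≡ true → Walk E k z b → Walk E (suc k) a b

  module _ {E : BRel n} where

    Walk-weaken : ∀ {k k′ a b} → k ≤ k′ → Walk E k a b → Walk E k′ a b
    Walk-weaken _          stay       = stay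
    Walk-weaken (s≤s k≤k′) (step e w) = step e (Walk-weaken k≤k′ w)

    Walk-snoc : ∀ {k a z b} → Walk E k a z → E z b ≡ true → Walk E (suc k) a b
    Walk-snoc stay        e = step e stay
    Walk-snoc (step e′ w) e = step e′ (Walk-snoc w e)

    Walk-unsnoc : ∀ {k a b} → Walk E (suc k) a b →
                  Walk E k a b ⊎ ∃[ z ] Walk E k a z × E z b ≡ true
    Walk-unsnoc stay                  = inj₁ stay
    Walk-unsnoc {zero}  (step e stay) = inj₂ (_ , stay , e)
    Walk-unsnoc {suc k} (step e w) with Walk-unsnoc w
    ... | inj₁ w′            = inj₁ (step e w′)
    ... | inj₂ (z , w′ , e′) = inj₂ (z , step e w′ , e′)

    reach⇒Walk : ∀ k {a b} → reach E k a b ≡ true → Walk E k a b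
    reach⇒Walk zero r with eqb⇒≡ r
    ... | refl = stay
    reach⇒Walk (suc k) {a} {b} r with ∨-elim {reach E k a b} r
    ... | inj₁ r′ = Walk-weaken (n≤1+n k) (reach⇒Walk k r′)
    ... | inj₂ r′ with any-elim _ (allFin n) r′
    ... | z , rz = Walk-snoc (reach⇒Walk k (∧-elimˡ rz)) (∧-elimʳ rz)

    Walk⇒reach : ∀ k {a b} → Walk E k a b → reach E k a b ≡ true
    Walk⇒reach zero    stay = eqb-refl _
    Walk⇒reach (suc k) {a} {b} w with Walk-unsnoc w
    ... | inj₁ w′           = ∨-introˡ (Walk⇒reach k w′)
    ... | inj₂ (z , w′ , e) =
      ∨-introʳ {reach E k a b} (any-intro _ (∈-allFin z) (∧-intro (Walk⇒reach k w′) e))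

  Walk-mono : ∀ {E E′ k a b} → E ⊆ᴱ E′ → Walk E k a b → Walk E′ k a b
  Walk-mono E⊆E′ stay       = stay
  Walk-mono E⊆E′ (step e w) = step (E⊆E′ e) (Walk-mono E⊆E′ w)

  reach-mono : ∀ {E E′} k {a b} → E ⊆ᴱ E′ → reach E k a b ≡ true → reach E′ k a b ≡ true
  reach-mono k E⊆E′ = Walk⇒reach k ∘ Walk-mono E⊆E′ ∘ reach⇒Walk k

  module _ (E : BRel n) (h : ℕ) where

    nbr⇒≢ : ∀ x y → nbr E h x y ≡ true → x ≢ y
    nbr⇒≢ x y nb refl = contradiction (trans (cong not (sym (eqb-refl x))) (∧-elimˡ nb)) λ ()

    nbr⇒reach : ∀ x y → nbr E h x y ≡ true → reach E h x y ≡ true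
    nbr⇒reach x y = ∧-elimʳ {not (eqb y x)}

    tri⇒nbrˡ : ∀ u v w → tri E h u v w ≡ true → nbr E h u w ≡ true
    tri⇒nbrˡ u v w = ∧-elimˡ

    tri⇒nbrʳ : ∀ u v w → tri E h u v w ≡ true → nbr E h v w ≡ true
    tri⇒nbrʳ u v w = ∧-elimʳ {nbr E h u w}

    tri-sym : ∀ u v w → tri E h u v w ≡ tri E h v u w
    tri-sym u v w = ∧-comm (nbr E h u w) (nbr E h v w)

    sup-sym : ∀ u v → sup E h u v ≡ sup E h v u
    sup-sym u v = countB-cong (tri-sym u v) (allFin n)

  module _ {E E′ : BRel n} (h : ℕ) (E⊆E′ : E ⊆ᴱ E′) where

    nbr-mono : ∀ x y → nbr E h x y ≡ true → nbr E′ h x y ≡ true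
    nbr-mono x y nb = ∧-intro (∧-elimˡ nb) (reach-mono h E⊆E′ (nbr⇒reach E h x y nb))

    tri-mono : ∀ u v w → tri E h u v w ≡ true → tri E′ h u v w ≡ true
    tri-mono u v w t =
      ∧-intro (nbr-mono u w (tri⇒nbrˡ E h u v w t)) (nbr-mono v w (tri⇒nbrʳ E h u v w t))

    sup-mono : ∀ u v → sup E h u v ≤ sup E′ h u v
    sup-mono u v = countB-mono (tri-mono u v) (allFin n)

  Linked : BRel n → List (Fin n) → Set
  Linked E p = All (λ (x , y) → E x y ≡ true) (edgesOf p)

  record Path (E : BRel n) (k : ℕ) (a b : Fin n) : Set where
    constructor path
    field
      inner  : List (Fin n)
      short  : length inner < k
      nodup  : distinct (a ∷ inner ++ [ b ]) ≡ true
      linked : Linked E (a ∷ inner ++ [ b ])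

  route : ∀ {E k a b} → Path E k a b → List (Fin n)
  route {a = a} {b = b} P = a ∷ Path.inner P ++ [ b ]

  route-edges≢[] : ∀ (a : Fin n) inner b → edgesOf (a ∷ inner ++ [ b ]) ≢ []
  route-edges≢[] a []      b ()
  route-edges≢[] a (_ ∷ _) b ()

  Linked-suffix : ∀ {E} pre s → Linked E (pre ++ s) → Linked E s
  Linked-suffix []            s       l       = l
  Linked-suffix (x ∷ [])      []      l       = l
  Linked-suffix (x ∷ [])      (_ ∷ _) (_ ∷ l) = l
  Linked-suffix (x ∷ y ∷ pre) s       (_ ∷ l) = Linked-suffix (y ∷ pre) s l

  distinct-suffix : ∀ (pre s : List (Fin n)) → distinct (pre ++ s) ≡ true → distinct s ≡ true
  distinct-suffix []        s d = d
  distinct-suffix (x ∷ pre) s d =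
    distinct-suffix pre s (∧-elimʳ {not (any (eqb x) (pre ++ s))} d)

  occurrence-split : ∀ a b z inner → any (eqb a) (z ∷ inner ++ [ b ]) ≡ true →
    a ≡ b ⊎ ∃[ pre ] ∃[ rest ] (z ∷ inner ++ [ b ] ≡ pre ++ a ∷ rest ++ [ b ])
                               × length rest ≤ length inner
  occurrence-split a b z inner occ with eqb a z in a≡ᵇz
  ... | true with eqb⇒≡ a≡ᵇz
  ...   | refl = inj₂ ([] , inner , refl , ≤-refl)
  occurrence-split a b z []           occ | false =
    inj₁ (eqb⇒≡ (trans (sym (∨-identityʳ _)) occ))
  occurrence-split a b z (z′ ∷ inner) occ | false with occurrence-split a b z′ inner occ
  ... | inj₁ a≡b                    = inj₁ a≡b
  ... | inj₂ (pre , rest , eq , le) = inj₂ (z ∷ pre , rest , cong (z ∷_) eq , m≤n⇒m≤1+n le)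

  -- If a already lies on the path, cut the path back to the suffix starting at a.
  cons-or-cut : ∀ {E k a z b} → E a z ≡ true → Path E k z b → a ≡ b ⊎ Path E (suc k) a b
  cons-or-cut {E} {a = a} {z} {b} e (path inner short nodup linked)
    with any (eqb a) (z ∷ inner ++ [ b ]) in occ
  ... | false = inj₂ (path (z ∷ inner) (s≤s short) (∧-intro (cong not occ) nodup) (e ∷ linked))
  ... | true with occurrence-split a b z inner occ
  ...   | inj₁ a≡b = inj₁ a≡b
  ...   | inj₂ (pre , rest , eq , le) = inj₂ (path rest (s≤s (≤-trans le (<⇒≤ short)))
            (distinct-suffix pre (a ∷ rest ++ [ b ]) (subst (λ p → distinct p ≡ true) eq nodup))
            (Linked-suffix pre (a ∷ rest ++ [ b ]) (subst (Linked E) eq linked)))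

  Walk⇒Path : ∀ {E k a b} → Walk E k a b → a ≡ b ⊎ Path E k a b
  Walk⇒Path stay = inj₁ refl
  Walk⇒Path (step {a = a} {z} e w) with Walk⇒Path w
  ... | inj₂ P    = cons-or-cut e P
  ... | inj₁ refl with a ≟ z
  ...   | yes a≡z = inj₁ a≡z
  ...   | no  a≢z = inj₂ (path [] (s≤s z≤n)
                            (∧-intro (cong not (trans (∨-identityʳ _) (eqb-≢ a≢z))) refl) (e ∷ []))

  Linked⇒Walk : ∀ {E} a inner b → Linked E (a ∷ inner ++ [ b ]) →
                Walk E (suc (length inner)) a b
  Linked⇒Walk a []          b (e ∷ []) = step e stay
  Linked⇒Walk a (z ∷ inner) b (e ∷ l)  = step e (Linked⇒Walk z inner b l)

  Path⇒Walk : ∀ {E k a b} → Path E k a b → Walk E k a b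
  Path⇒Walk {a = a} {b = b} (path inner short _ linked) =
    Walk-weaken short (Linked⇒Walk a inner b linked)

  Path-mono : ∀ {E E′ k a b} → E ⊆ᴱ E′ → Path E k a b → Path E′ k a b
  Path-mono E⊆E′ (path inner short nodup linked) = path inner short nodup (All.map E⊆E′ linked)

  ∈-seqs : ∀ (xs : List (Fin n)) → xs ∈ seqs (length xs)
  ∈-seqs []       = here refl
  ∈-seqs (x ∷ xs) =
    ∈-concatMap⁺ (λ y → map (y ∷_) (seqs (length xs))) (∈-allFin x) (∈-map⁺ (x ∷_) (∈-seqs xs))

  ∈-seqs⇒length : ∀ m {xs : List (Fin n)} → xs ∈ seqs m → length xs ≡ m
  ∈-seqs⇒length zero    (here refl) = refl
  ∈-seqs⇒length (suc m) xs∈ with ∈-concatMap⁻ (λ y → map (y ∷_) (seqs m)) {xs = allFin n} xs∈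
  ... | x , _ , xs∈′ with ∈-map⁻ (x ∷_) xs∈′
  ... | ys , ys∈ , refl = cong suc (∈-seqs⇒length m ys∈)

  -- Bottlenecks

  -- paths A h a b unfolds to filterB (isPath A) (concatMap (routes a b) (upTo h)),
  -- and bottleneck A h H a b to maxL (map (weight H) (paths A h a b)).
  routes : Fin n → Fin n → ℕ → List (List (Fin n))
  routes a b m = map (λ mid → a ∷ (mid ++ [ b ])) (seqs m)

  weight : (Fin n → Fin n → ℕ) → List (Fin n) → ℕ
  weight H p = minL (map (λ (x , y) → H x y) (edgesOf p))

  module _ (A : BRel n) (h : ℕ) where

    ∈-paths⁺ : ∀ {a b} (P : Path A h a b) → route P ∈ paths A h a b
    ∈-paths⁺ {a} {b} (path inner short nodup linked) =
      ∈-filterB⁺ (isPath A)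
        (∈-concatMap⁺ (routes a b) (∈-upTo⁺ short)
                      (∈-map⁺ (λ mid → a ∷ (mid ++ [ b ])) (∈-seqs inner)))
        (∧-intro nodup (all-intro _ linked))

    ∈-paths⁻ : ∀ {a b p} → p ∈ paths A h a b → Σ (Path A h a b) λ P → p ≡ route P
    ∈-paths⁻ {a} {b} p∈ with ∈-filterB⁻ (isPath A) (concatMap (routes a b) (upTo h)) p∈
    ... | p∈′ , isP with ∈-concatMap⁻ (routes a b) {xs = upTo h} p∈′
    ... | m , m∈ , p∈″ with ∈-map⁻ (λ mid → a ∷ (mid ++ [ b ])) p∈″
    ... | inner , inner∈ , refl =
      path inner (subst (_< h) (sym (∈-seqs⇒length m inner∈)) (∈-upTo⁻ m∈))
           (∧-elimˡ isP) (all-elim _ _ (∧-elimʳ {distinct (a ∷ inner ++ [ b ])} isP)) , refl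

    bottleneck-mono : ∀ {H′ H} → (∀ x y → H′ x y ≤ H x y) →
                      ∀ a b → bottleneck A h H′ a b ≤ bottleneck A h H a b
    bottleneck-mono H′≤H a b =
      maxL-map-mono (λ p → minL-map-mono (λ (x , y) → H′≤H x y) (edgesOf p)) (paths A h a b)

    ≤bottleneck⁺ : ∀ {E H c} → E ⊆ᴱ A → (∀ {x y} → E x y ≡ true → c ≤ H x y) →
                   ∀ a b → reach E h a b ≡ true → a ≢ b → c ≤ bottleneck A h H a b
    ≤bottleneck⁺ {E} {H} {c} E⊆A c≤H a b r a≢b with Walk⇒Path (reach⇒Walk h r)
    ... | inj₁ a≡b = contradiction a≡b a≢b
    ... | inj₂ P@(path inner _ _ linked) =
      ≤-trans c≤weight (x≤maxL (∈-map⁺ (weight H) (∈-paths⁺ (Path-mono E⊆A P))))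
      where
      c≤weight : c ≤ weight H (route P)
      c≤weight =
        ≤minL-map⁺ _ (edgesOf (route P)) (route-edges≢[] a inner b) (All.map c≤H linked)

    ≤bottleneck⁻ : ∀ {H c} a b → 0 < c → c ≤ bottleneck A h H a b →
                   reach (superlevel A H c) h a b ≡ true
    ≤bottleneck⁻ {H} {c} a b 0<c c≤bn
      with maxL-witness (map (weight H) (paths A h a b)) 0<c c≤bn
    ... | _ , w∈ , c≤w with ∈-map⁻ (weight H) {xs = paths A h a b} w∈
    ... | p , p∈ , refl with ∈-paths⁻ p∈
    ... | P@(path inner short nodup linked) , refl =
      Walk⇒reach h (Path⇒Walk (path inner short nodup heavy))
      where
      heavy : Linked (superlevel A H c) (route P)
      heavy = All.zipWith (λ (e , c≤He) → ∧-intro e (≤⇒≤ᵇ≡true c≤He))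
                          (linked , ≤minL-map⁻ _ (edgesOf (route P)) c≤w)

-- One step of the iteration

-- Good h k S unfolds to Dense h (k ∸ 2) (Subgraph.ES S).
Dense : ∀ {n} → ℕ → ℕ → BRel n → Set
Dense h c E = ∀ u v → E u v ≡ true → c ≤ sup E h u v

module _ {n : ℕ} (A : BRel n) (h : ℕ) where

  minBottleneck : (Fin n → Fin n → ℕ) → Fin n → Fin n → Fin n → ℕ
  minBottleneck H u v w = bottleneck A h H u w ⊓ bottleneck A h H v w

  triangleWeights : (Fin n → Fin n → ℕ) → Fin n → Fin n → List ℕ
  triangleWeights H u v = map (minBottleneck H u v) (filterB (tri A h u v) (allFin n))

  -- Hsup G h (suc m) unfolds to Step (Graph.adj G) h (Hsup G h m).
  Step : (Fin n → Fin n → ℕ) → Fin n → Fin n → ℕ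
  Step H u v = hindex (triangleWeights H u v)

  supporter : (Fin n → Fin n → ℕ) → ℕ → Fin n → Fin n → Fin n → Bool
  supporter H c u v w = tri A h u v w ∧ (c ≤ᵇ minBottleneck H u v w)

  supporter⁺ : ∀ H c u v w → tri A h u v w ≡ true → c ≤ minBottleneck H u v w →
               supporter H c u v w ≡ true
  supporter⁺ H c u v w t c≤min = ∧-intro t (≤⇒≤ᵇ≡true c≤min)

  supporter⇒tri : ∀ H c u v w → supporter H c u v w ≡ true → tri A h u v w ≡ true
  supporter⇒tri H c u v w = ∧-elimˡ

  supporter⇒≤ : ∀ H c u v w → supporter H c u v w ≡ true → c ≤ minBottleneck H u v w
  supporter⇒≤ H c u v w = ≤ᵇ≡true⇒≤ ∘ ∧-elimʳ {tri A h u v w}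

  count≥-triangleWeights : ∀ H c u v →
    count≥ c (triangleWeights H u v) ≡ countB (supporter H c u v) (allFin n)
  count≥-triangleWeights H c u v =
    countB-map-filterB (c ≤ᵇ_) (minBottleneck H u v) (tri A h u v) (allFin n)

  ≤Step⁺ : ∀ {H c} u v → c ≤ countB (supporter H c u v) (allFin n) → c ≤ Step H u v
  ≤Step⁺ {H} {c} u v =
    ≤hindex⁺ (triangleWeights H u v) ∘ subst (c ≤_) (sym (count≥-triangleWeights H c u v))

  ≤Step⁻ : ∀ {H c} u v → c ≤ Step H u v → c ≤ countB (supporter H c u v) (allFin n)
  ≤Step⁻ {H} {c} u v =
    subst (c ≤_) (count≥-triangleWeights H c u v) ∘ ≤hindex⁻ (triangleWeights H u v)

  Step≤sup : ∀ H u v → Step H u v ≤ sup A h u v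
  Step≤sup H u v = begin
    Step H u v                      ≤⟨ hindex≤length (triangleWeights H u v) ⟩
    length (triangleWeights H u v)  ≡⟨ length-map (minBottleneck H u v) triangle ⟩
    length triangle                 ≡⟨ length-filterB (tri A h u v) (allFin n) ⟩
    sup A h u v                     ∎
    where
    open ≤-Reasoning
    triangle = filterB (tri A h u v) (allFin n)

  Step-mono : ∀ {H′ H} → (∀ x y → H′ x y ≤ H x y) → ∀ u v → Step H′ u v ≤ Step H u v
  Step-mono {H′} {H} H′≤H u v =
    ≤Step⁺ u v (≤-trans (≤Step⁻ u v ≤-refl) (countB-mono stronger (allFin n)))
    where
    c = Step H′ u v
    stronger : ∀ w → supporter H′ c u v w ≡ true → supporter H c u v w ≡ true
    stronger w s = supporter⁺ H c u v w (supporter⇒tri H′ c u v w s)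
      (≤-trans (supporter⇒≤ H′ c u v w s)
               (⊓-mono-≤ (bottleneck-mono A h H′≤H u w) (bottleneck-mono A h H′≤H v w)))

  Step-sym : ∀ H u v → Step H u v ≡ Step H v u
  Step-sym H u v = cong hindex (begin
    triangleWeights H u v
      ≡⟨ cong (map (minBottleneck H u v)) (filterB-cong (tri-sym A h u v) (allFin n)) ⟩
    map (minBottleneck H u v) (filterB (tri A h v u) (allFin n))
      ≡⟨ map-cong (λ w → ⊓-comm (bottleneck A h H u w) (bottleneck A h H v w)) _ ⟩
    triangleWeights H v u ∎)
    where open ≡-Reasoning

  dense⇒≤Step : ∀ {E H c} → E ⊆ᴱ A → Dense h c E → (∀ {x y} → E x y ≡ true → c ≤ H x y) →
                ∀ u v → E u v ≡ true → c ≤ Step H u v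
  dense⇒≤Step {E} {H} {c} E⊆A dense c≤H u v uv =
    ≤Step⁺ u v (≤-trans (dense u v uv) (countB-mono supports (allFin n)))
    where
    ≤bottleneck : ∀ x w → nbr E h x w ≡ true → c ≤ bottleneck A h H x w
    ≤bottleneck x w nb = ≤bottleneck⁺ A h E⊆A c≤H x w (nbr⇒reach E h x w nb) (nbr⇒≢ E h x w nb)
    supports : ∀ w → tri E h u v w ≡ true → supporter H c u v w ≡ true
    supports w t = supporter⁺ H c u v w (tri-mono h E⊆A u v w t)
      (⊓-glb (≤bottleneck u w (tri⇒nbrˡ E h u v w t)) (≤bottleneck v w (tri⇒nbrʳ E h u v w t)))

  ≤Step⇒≤sup-superlevel : ∀ {H c} u v → 0 < c → c ≤ Step H u v →
                          c ≤ sup (superlevel A H c) h u v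
  ≤Step⇒≤sup-superlevel {H} {c} u v 0<c c≤Step =
    ≤-trans (≤Step⁻ u v c≤Step) (countB-mono supported (allFin n))
    where
    reachable : ∀ x w → nbr A h x w ≡ true → c ≤ bottleneck A h H x w →
                nbr (superlevel A H c) h x w ≡ true
    reachable x w nb c≤bn = ∧-intro (∧-elimˡ nb) (≤bottleneck⁻ A h x w 0<c c≤bn)
    supported : ∀ w → supporter H c u v w ≡ true → tri (superlevel A H c) h u v w ≡ true
    supported w s =
      ∧-intro (reachable u w (tri⇒nbrˡ A h u v w t) (m≤n⊓o⇒m≤n (bottleneck A h H u w) _ c≤min))
              (reachable v w (tri⇒nbrʳ A h u v w t) (m≤n⊓o⇒m≤o _ (bottleneck A h H v w) c≤min))
      where
      t = supporter⇒tri H c u v w s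
      c≤min = supporter⇒≤ H c u v w s

-- The limit of the iteration

module _ (G : Graph) (h : ℕ) where
  open Graph G using (n; adj) renaming (sym to adj-sym)

  Hsup-antitone : ∀ m u v → Hsup G h (suc m) u v ≤ Hsup G h m u v
  Hsup-antitone zero    = Step≤sup adj h (Hsup G h zero)
  Hsup-antitone (suc m) = Step-mono adj h (Hsup-antitone m)

  Hsup-sym : ∀ m u v → Hsup G h m u v ≡ Hsup G h m v u
  Hsup-sym zero    = sup-sym adj h
  Hsup-sym (suc m) = Step-sym adj h (Hsup G h m)

  dense⇒≤Hsup : ∀ {E c} → E ⊆ᴱ adj → Dense h c E →
                ∀ m u v → E u v ≡ true → c ≤ Hsup G h m u v
  dense⇒≤Hsup E⊆A dense zero    u v uv = ≤-trans (dense u v uv) (sup-mono h E⊆A u v)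
  dense⇒≤Hsup E⊆A dense (suc m) u v uv =
    dense⇒≤Step adj h E⊆A dense (λ {x} {y} → dense⇒≤Hsup E⊆A dense m x y) u v uv

  Hsup-stabilises : ∃[ N ] (∀ u v → Hsup G h (suc N) u v ≡ Hsup G h N u v)
  Hsup-stabilises with antitone-family⇒plateau (λ m (u , v) → Hsup G h m u v)
                         (cartesianProduct (allFin n) (allFin n))
                         (λ (u , v) → ∈-cartesianProduct⁺ (∈-allFin u) (∈-allFin v))
                         (λ m (u , v) → Hsup-antitone m u v)
  ... | N , plateau = N , λ u v → plateau (u , v)

  module Limit (N : ℕ) (stable : ∀ u v → Hsup G h (suc N) u v ≡ Hsup G h N u v) where

    L : Fin n → Fin n → ℕ
    L = Hsup G h N

    superlevelSubgraph : ℕ → Subgraph G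
    superlevelSubgraph c = record
      { VS     = λ _ → true
      ; ES     = superlevel adj L c
      ; ES-sym = λ u v → cong₂ (λ e l → e ∧ (c ≤ᵇ l)) (adj-sym u v) (Hsup-sym N u v)
      ; ES⊆E   = λ _ _ → ∧-elimˡ
      ; ES-l   = λ _ _ _ → refl
      ; ES-r   = λ _ _ _ → refl
      }

    superlevel-dense : ∀ c → Dense h c (superlevel adj L c)
    superlevel-dense zero    _ _ _  = z≤n
    superlevel-dense (suc c) u v uv = ≤Step⇒≤sup-superlevel adj h u v (s≤s z≤n)
      (subst (suc c ≤_) (sym (stable u v)) (≤ᵇ≡true⇒≤ (∧-elimʳ {adj u v} uv)))

    superlevel-isTruss : ∀ k → IsTruss h k (superlevelSubgraph (k ∸ 2))
    superlevel-isTruss k = superlevel-dense (k ∸ 2) , λ S good → (λ _ _ → refl) , λ u v uv →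
      ∧-intro (Subgraph.ES⊆E S u v uv)
              (≤⇒≤ᵇ≡true (dense⇒≤Hsup (Subgraph.ES⊆E S _ _) good N u v uv))

    edge∈own-superlevel : ∀ {u v} → adj u v ≡ true → superlevel adj L (L u v) u v ≡ true
    edge∈own-superlevel {u} {v} uv = ∧-intro uv (≤⇒≤ᵇ≡true (≤-refl {L u v}))

    trussness : ∀ {u v} → adj u v ≡ true → IsTrussness G h u v (2 + L u v)
    trussness {u} {v} uv =
      (superlevelSubgraph (L u v) , superlevel-isTruss (2 + L u v) , edge∈own-superlevel uv) ,
      maximal
      where
      maximal : ∀ k → InTruss G h k u v → k ≤ 2 + L u v
      maximal k (S , (good , _) , uvS) = ≤-trans (m≤n+m∸n k 2)
        (+-monoʳ-≤ 2 (dense⇒≤Hsup (Subgraph.ES⊆E S _ _) good N u v uvS))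

    converges : ∀ {u v m} → adj u v ≡ true → N ≤ m → Hsup G h m u v ≡ L u v
    converges {u} {v} {m} uv N≤m = ≤-antisym
      (antitone⇒≤ (λ m → Hsup G h m u v) (λ m → Hsup-antitone m u v) N≤m)
      (dense⇒≤Hsup ∧-elimˡ (superlevel-dense (L u v)) m u v (edge∈own-superlevel uv))

theorem2 : (G : Graph) (h : ℕ) → 1 ≤ h →
    (u v : Fin (Graph.n G)) → Graph.adj G u v ≡ true →
    Σ ℕ (λ t → IsTrussness G h u v t ×
      Σ ℕ (λ N → (m : ℕ) → N ≤ m → Hsup G h m u v ≡ t ∸ 2))
theorem2 G h _ u v uv with Hsup-stabilises G h
... | N , stable = 2 + L u v , trussness uv , N , λ m → converges uv
  where open Limit G h N stable
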